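{- Let $R$ and $S$ be finite rings with identity such that $Cl_2(R) \cong Cl_2(S)$. Then $|Id(R)| = |Id(S)|$ and $|U(R)| = |U(S)|$.
   Context: For a ring $R$ with identity, $Id(R)$ denotes the set of idempotents and $U(R)$ the set of units of $R$. The clean graph $Cl(R)$ has vertex set $Id(R) \times U(R)$, and two distinct vertices $(e,u)$ and $(f,v)$ are adjacent if and only if $ef=fe=0$ or $uv=vu=1$. $Cl_2(R)$ is the induced subgraph of $Cl(R)$ on the vertex set $\{(e,u): e \in Id(R)\setminus\{0\},\ u \in U(R)\}$. $\cong$ denotes graph isomorphism. -}

module Defs where

open import Level using (Level; _⊔_; 0ℓ)
open import Algebra.Bundles using (Ring)
open import Data.Fin using (Fin)
open import Data.Nat using (ℕ)
open import Data.Product using (Σ; ∃; _×_; _,_; proj₁; proj₂)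
open import Data.Sum using (_⊎_)
open import Relation.Nullary using (¬_)
open import Relation.Binary.Bundles using (Setoid)
open import Relation.Binary.PropositionalEquality as ≡ using (_≡_)
open import Function.Bundles using (Inverse)

private variable c ℓ c₁ ℓ₁ c₂ ℓ₂ : Level

IsFiniteRing : Ring c ℓ → Set (c ⊔ ℓ)
IsFiniteRing R = ∃ λ (n : ℕ) → Inverse (≡.setoid (Fin n)) (Ring.setoid R)

module _ (R : Ring c ℓ) where
  open Ring R

  IsIdempotent : Carrier → Set ℓ
  IsIdempotent e = e * e ≈ e

  IsUnit : Carrier → Set (c ⊔ ℓ)
  IsUnit u = ∃ λ v → (u * v ≈ 1#) × (v * u ≈ 1#)

  IdSetoid : Setoid (c ⊔ ℓ) ℓ
  IdSetoid = record
    { Carrier = Σ Carrier IsIdempotent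
    ; _≈_ = λ x y → proj₁ x ≈ proj₁ y
    ; isEquivalence = record { refl = refl ; sym = sym ; trans = trans } }

  USetoid : Setoid (c ⊔ ℓ) ℓ
  USetoid = record
    { Carrier = Σ Carrier IsUnit
    ; _≈_ = λ x y → proj₁ x ≈ proj₁ y
    ; isEquivalence = record { refl = refl ; sym = sym ; trans = trans } }

  record Cl₂Vertex : Set (c ⊔ ℓ) where
    constructor vtx
    field
      idem   : Carrier
      isIdem : IsIdempotent idem
      nonzero : ¬ (idem ≈ 0#)
      unit   : Carrier
      isUnit : IsUnit unit
  open Cl₂Vertex public

  Cl₂Setoid : Setoid (c ⊔ ℓ) ℓ
  Cl₂Setoid = record
    { Carrier = Cl₂Vertex
    ; _≈_ = λ x y → (idem x ≈ idem y) × (unit x ≈ unit y)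
    ; isEquivalence = record
      { refl = refl , refl
      ; sym = λ (p , q) → sym p , sym q
      ; trans = λ (p , q) (p' , q') → trans p p' , trans q q' } }

  Cl₂Adj : Cl₂Vertex → Cl₂Vertex → Set ℓ
  Cl₂Adj x y =
    ¬ ((idem x ≈ idem y) × (unit x ≈ unit y)) ×
    (((idem x * idem y ≈ 0#) × (idem y * idem x ≈ 0#)) ⊎
     ((unit x * unit y ≈ 1#) × (unit y * unit x ≈ 1#)))

Cl₂Iso : Ring c₁ ℓ₁ → Ring c₂ ℓ₂ → Set (c₁ ⊔ ℓ₁ ⊔ c₂ ⊔ ℓ₂)
Cl₂Iso R S = Σ (Inverse (Cl₂Setoid R) (Cl₂Setoid S)) λ φ →
  ∀ x y → (Cl₂Adj R x y → Cl₂Adj S (Inverse.to φ x) (Inverse.to φ y)) ×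
          (Cl₂Adj S (Inverse.to φ x) (Inverse.to φ y) → Cl₂Adj R x y)

-- |A| = |B| for finite (sub)setoids: there is a bijection between them.
_≅ˢ_ : Setoid c₁ ℓ₁ → Setoid c₂ ℓ₂ → Set (c₁ ⊔ ℓ₁ ⊔ c₂ ⊔ ℓ₂)
A ≅ˢ B = Inverse A B

{-# OPTIONS --safe #-}

-- Let φ : Cl₂(R) ≅ Cl₂(S) with R nontrivial, and φ(1,1) = (e,u). For every nonzero
-- idempotent f of S the vertex (f,u⁻¹) is φ(1,1) or adjacent to it, so its preimage is
-- (1,1) or adjacent to (1,1). A vertex (f′,v) adjacent to (1,1) has v = 1, because
-- 1·f′ = 0 is impossible for f′ ≠ 0. Hence f ↦ (idempotent of φ⁻¹(f,u⁻¹)) injects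
-- Id(S)∖{0} into Id(R)∖{0}; by symmetry and finiteness |Id(R)| = |Id(S)|. Since
-- Cl₂(R) ≅ (Id(R)∖{0}) × U(R) and 1 ∈ Id(R)∖{0}, cancelling gives |U(R)| = |U(S)|.
-- Trivial rings have empty Cl₂, so R is trivial exactly when S is.

module Submission where

open import Level using (Level; _⊔_)
open import Algebra.Bundles using (Ring)
open import Data.Empty using (⊥-elim)
open import Data.Fin using (Fin; zero; suc; _≟_)
open import Data.Fin.Properties using (suc-injective; injective⇒≤; nonZeroIndex; any?; *↔×)
open import Data.Nat as ℕ using (ℕ; _≤_)
open import Data.Nat.Properties using (≤-antisym; *-cancelˡ-≡)
open import Data.Product using (Σ; ∃; _×_; _,_; proj₁; proj₂; map₂)
open import Data.Product.Relation.Binary.Pointwise.NonDependent using (_×ₛ_; Pointwise-≡↔≡)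
open import Data.Product.Function.NonDependent.Setoid using (_×-inverse_)
open import Data.Sum as ⊎ using (inj₁; inj₂)
open import Function.Base using (_∘_)
open import Function.Bundles using (Inverse; Injection)
open import Function.Properties.Inverse using (Inverse⇒Injection)
import Function.Construct.Composition as Compose
import Function.Construct.Symmetry as Symmetry
open import Relation.Binary.Bundles using (Setoid)
open import Relation.Binary.Definitions using (Decidable; _Respects_)
import Relation.Binary.Construct.On as On
import Relation.Binary.Reasoning.Setoid as ≈-Reasoning
open import Relation.Binary.PropositionalEquality as ≡ using (_≡_)
open import Relation.Nullary using (¬_; Dec; yes; no)
open import Relation.Nullary.Decidable using (_×-dec_; ¬?; map′; decidable-stable)
import Relation.Unary as U
open import Defs

private variable
  a b ℓ₁ ℓ₂ p : Level
  m n : ℕ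
  A : Setoid a ℓ₁
  B : Setoid b ℓ₂

Enumeration : ℕ → Setoid a ℓ₁ → Set (a ⊔ ℓ₁)
Enumeration n A = Inverse (≡.setoid (Fin n)) A

Subsetoid : (A : Setoid a ℓ₁) → (Setoid.Carrier A → Set p) → Setoid (a ⊔ p) ℓ₁
Subsetoid A P = On.setoid A (proj₁ {B = P})

module _ {A : Setoid a ℓ₁} where
  open Setoid A

  mkEnumeration : (to : Fin n → Carrier) (from : Carrier → Fin n) →
    (∀ {x y} → x ≈ y → from x ≡ from y) →
    (∀ x → to (from x) ≈ x) → (∀ i → from (to i) ≡ i) → Enumeration n A
  mkEnumeration to from from-cong to∘from from∘to = record
    { to = to ; from = from
    ; to-cong = λ { ≡.refl → refl } ; from-cong = from-cong
    ; inverse = (λ { {x} ≡.refl → to∘from x }) , λ {i} eq → ≡.trans (from-cong eq) (from∘to i) }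

module _ {n} (Q : Fin (ℕ.suc n) → Set p) {k}
         (e : Enumeration k (Subsetoid (≡.setoid (Fin n)) (Q ∘ suc))) where
  private module E = Inverse e

  cons-enumeration : Q zero → Enumeration (ℕ.suc k) (Subsetoid (≡.setoid (Fin (ℕ.suc n))) Q)
  cons-enumeration q₀ = mkEnumeration to from from-cong to∘from from∘to
    where
    to : Fin (ℕ.suc k) → Σ (Fin (ℕ.suc n)) Q
    to zero    = zero , q₀
    to (suc i) = suc (proj₁ (E.to i)) , proj₂ (E.to i)
    from : Σ (Fin (ℕ.suc n)) Q → Fin (ℕ.suc k)
    from (zero  , _) = zero
    from (suc j , q) = suc (E.from (j , q))
    from-cong : ∀ {x y} → proj₁ x ≡ proj₁ y → from x ≡ from y
    from-cong {zero  , _} {zero  , _} _  = ≡.refl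
    from-cong {suc _ , _} {suc _ , _} eq = ≡.cong suc (E.from-cong (suc-injective eq))
    to∘from : ∀ x → proj₁ (to (from x)) ≡ proj₁ x
    to∘from (zero  , _) = ≡.refl
    to∘from (suc j , q) = ≡.cong suc (E.strictlyInverseˡ (j , q))
    from∘to : ∀ i → from (to i) ≡ i
    from∘to zero    = ≡.refl
    from∘to (suc i) = ≡.cong suc (E.strictlyInverseʳ i)

  skip-enumeration : ¬ Q zero → Enumeration k (Subsetoid (≡.setoid (Fin (ℕ.suc n))) Q)
  skip-enumeration ¬q₀ = mkEnumeration to from from-cong to∘from E.strictlyInverseʳ
    where
    to : Fin k → Σ (Fin (ℕ.suc n)) Q
    to i = suc (proj₁ (E.to i)) , proj₂ (E.to i)
    from : Σ (Fin (ℕ.suc n)) Q → Fin k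
    from (zero  , q) = ⊥-elim (¬q₀ q)
    from (suc j , q) = E.from (j , q)
    from-cong : ∀ {x y} → proj₁ x ≡ proj₁ y → from x ≡ from y
    from-cong {zero  , q} _  = ⊥-elim (¬q₀ q)
    from-cong {suc _ , _} {suc _ , _} eq = E.from-cong (suc-injective eq)
    to∘from : ∀ x → proj₁ (to (from x)) ≡ proj₁ x
    to∘from (zero  , q) = ⊥-elim (¬q₀ q)
    to∘from (suc j , q) = ≡.cong suc (E.strictlyInverseˡ (j , q))

Fin-subsetoid-enumeration : ∀ n {Q : Fin n → Set p} → U.Decidable Q →
  ∃ λ k → Enumeration k (Subsetoid (≡.setoid (Fin n)) Q)
Fin-subsetoid-enumeration ℕ.zero _ =
  0 , mkEnumeration (λ ()) (λ { (() , _) }) (λ { {() , _} }) (λ { (() , _) }) (λ ())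
Fin-subsetoid-enumeration (ℕ.suc n) {Q} Q? with Fin-subsetoid-enumeration n (Q? ∘ suc) | Q? zero
... | k , e | yes q₀ = ℕ.suc k , cons-enumeration Q e q₀
... | k , e | no ¬q₀ = k , skip-enumeration Q e ¬q₀

module _ (e : Enumeration n A) where
  open Setoid A
  private module E = Inverse e

  subsetoid-enumeration : {P : Carrier → Set p} → U.Decidable P → P Respects _≈_ →
    ∃ λ k → Enumeration k (Subsetoid A P)
  subsetoid-enumeration {P = P} P? resp =
    let k , eQ = Fin-subsetoid-enumeration n (P? ∘ E.to) in k , Compose.inverse eQ restrict
    where
    restrict : Inverse (Subsetoid (≡.setoid (Fin n)) (P ∘ E.to)) (Subsetoid A P)
    restrict = record
      { to = λ (i , Pi) → E.to i , Pi
      ; from = λ (x , Px) → E.from x , resp (sym (E.strictlyInverseˡ x)) Px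
      ; to-cong = E.to-cong ; from-cong = E.from-cong
      ; inverse = E.inverseˡ , E.inverseʳ }

  enumeration⇒≈-dec : Decidable _≈_
  enumeration⇒≈-dec x y =
    map′ (Injection.injective (Inverse⇒Injection (Symmetry.inverse e))) E.from-cong (E.from x ≟ E.from y)

  enumeration⇒∃? : {P : Carrier → Set p} → U.Decidable P → P Respects _≈_ → Dec (∃ P)
  enumeration⇒∃? P? resp =
    map′ (λ (i , Pi) → E.to i , Pi) (λ (x , Px) → E.from x , resp (sym (E.strictlyInverseˡ x)) Px)
         (any? (P? ∘ E.to))

injection⇒≤ : Enumeration m A → Enumeration n B → Injection A B → m ≤ n
injection⇒≤ eA eB f = injective⇒≤ (Injection.injective
  (Compose.injection (Inverse⇒Injection eA)
    (Compose.injection f (Inverse⇒Injection (Symmetry.inverse eB)))))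

injections⇒≡ : Enumeration m A → Enumeration n B → Injection A B → Injection B A → m ≡ n
injections⇒≡ eA eB f g = ≤-antisym (injection⇒≤ eA eB f) (injection⇒≤ eB eA g)

Inverse⇒≡ : Enumeration m A → Enumeration n B → Inverse A B → m ≡ n
Inverse⇒≡ eA eB f =
  injections⇒≡ eA eB (Inverse⇒Injection f) (Inverse⇒Injection (Symmetry.inverse f))

≡⇒Inverse : m ≡ n → Enumeration m A → Enumeration n B → Inverse A B
≡⇒Inverse ≡.refl eA eB = Compose.inverse (Symmetry.inverse eA) eB

×-enumeration : Enumeration m A → Enumeration n B → Enumeration (m ℕ.* n) (A ×ₛ B)
×-enumeration eA eB =
  Compose.inverse *↔× (Compose.inverse (Symmetry.inverse Pointwise-≡↔≡) (eA ×-inverse eB))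

IsSingleton : Setoid a ℓ₁ → Set (a ⊔ ℓ₁)
IsSingleton A = Σ Carrier λ c → ∀ x → x ≈ c
  where open Setoid A

singletons⇒Inverse : IsSingleton A → IsSingleton B → Inverse A B
singletons⇒Inverse {A = A} {B = B} (a , all≈a) (b , all≈b) = record
  { to = λ _ → b ; from = λ _ → a
  ; to-cong = λ _ → B.refl ; from-cong = λ _ → A.refl
  ; inverse = (λ {x} _ → B.sym (all≈b x)) , (λ {x} _ → A.sym (all≈a x)) }
  where module A = Setoid A; module B = Setoid B

module _ {c ℓ} (R : Ring c ℓ) where
  open Ring R

  IsTrivial : Set ℓ
  IsTrivial = 1# ≈ 0#

  NonzeroIdSetoid : Setoid (c ⊔ ℓ) ℓ
  NonzeroIdSetoid = Subsetoid setoid (λ e → IsIdempotent R e × ¬ e ≈ 0#)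

  IsIdempotent-resp : IsIdempotent R Respects _≈_
  IsIdempotent-resp x≈y x²≈x = trans (*-cong (sym x≈y) (sym x≈y)) (trans x²≈x x≈y)

  IsUnit-resp : IsUnit R Respects _≈_
  IsUnit-resp x≈y (v , xv≈1 , vx≈1) =
    v , trans (*-cong (sym x≈y) refl) xv≈1 , trans (*-cong refl (sym x≈y)) vx≈1

  Cl₂≅NonzeroId×U : Inverse (Cl₂Setoid R) (NonzeroIdSetoid ×ₛ USetoid R)
  Cl₂≅NonzeroId×U = record
    { to = λ (vtx e e² e≉0 u u⁻¹) → (e , e² , e≉0) , (u , u⁻¹)
    ; from = λ ((e , e² , e≉0) , (u , u⁻¹)) → vtx e e² e≉0 u u⁻¹
    ; to-cong = λ x≈y → x≈y ; from-cong = λ x≈y → x≈y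
    ; inverse = (λ x≈y → x≈y) , (λ x≈y → x≈y) }

  Cl₂-enumeration : ∀ {a b} → Enumeration a NonzeroIdSetoid → Enumeration b (USetoid R) →
    Enumeration (a ℕ.* b) (Cl₂Setoid R)
  Cl₂-enumeration eI eU = Compose.inverse (×-enumeration eI eU) (Symmetry.inverse Cl₂≅NonzeroId×U)

  trivial⇒≈0 : IsTrivial → ∀ x → x ≈ 0#
  trivial⇒≈0 1≈0 x = begin
    x       ≈⟨ *-identityʳ x ⟨
    x * 1#  ≈⟨ *-cong refl 1≈0 ⟩
    x * 0#  ≈⟨ zeroʳ x ⟩
    0#      ∎
    where open ≈-Reasoning setoid

  trivial⇒no-vertex : IsTrivial → ¬ Cl₂Vertex R
  trivial⇒no-vertex 1≈0 v = nonzero v (trivial⇒≈0 1≈0 (idem v))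

  trivial⇒Id-singleton : IsTrivial → IsSingleton (IdSetoid R)
  trivial⇒Id-singleton 1≈0 = (0# , zeroˡ 0#) , λ (e , _) → trivial⇒≈0 1≈0 e

  trivial⇒U-singleton : IsTrivial → IsSingleton (USetoid R)
  trivial⇒U-singleton 1≈0 =
    (1# , 1# , *-identityˡ 1# , *-identityˡ 1#) , λ (u , _) → trans (trivial⇒≈0 1≈0 u) (sym 1≈0)

  oneVertex : ¬ IsTrivial → Cl₂Vertex R
  oneVertex 1≉0 = vtx 1# (*-identityˡ 1#) 1≉0 1# (1# , *-identityˡ 1# , *-identityˡ 1#)

  Cl₂Adj-resp-≈ : ∀ {x x′ y y′} → Setoid._≈_ (Cl₂Setoid R) x x′ → Setoid._≈_ (Cl₂Setoid R) y y′ →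
    Cl₂Adj R x y → Cl₂Adj R x′ y′
  Cl₂Adj-resp-≈ (e≈e′ , u≈u′) (f≈f′ , v≈v′) (distinct , orthogonal-or-inverse) =
    (λ (e′≈f′ , u′≈v′) → distinct (≈-via e≈e′ e′≈f′ f≈f′ , ≈-via u≈u′ u′≈v′ v≈v′))
    , ⊎.map (products-resp e≈e′ f≈f′) (products-resp u≈u′ v≈v′) orthogonal-or-inverse
    where
    ≈-via : ∀ {x x′ y y′} → x ≈ x′ → x′ ≈ y′ → y ≈ y′ → x ≈ y
    ≈-via x≈x′ x′≈y′ y≈y′ = trans x≈x′ (trans x′≈y′ (sym y≈y′))

    products-resp : ∀ {x x′ y y′ z} → x ≈ x′ → y ≈ y′ →
      (x * y ≈ z) × (y * x ≈ z) → (x′ * y′ ≈ z) × (y′ * x′ ≈ z)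
    products-resp x≈x′ y≈y′ (xy≈z , yx≈z) =
      trans (*-cong (sym x≈x′) (sym y≈y′)) xy≈z , trans (*-cong (sym y≈y′) (sym x≈x′)) yx≈z

  adjacent-oneVertex⇒unit≈1 : (1≉0 : ¬ IsTrivial) → ∀ {w} → Cl₂Adj R (oneVertex 1≉0) w → unit w ≈ 1#
  adjacent-oneVertex⇒unit≈1 _ {w} (_ , inj₁ (1f≈0 , _)) =
    ⊥-elim (nonzero w (trans (sym (*-identityˡ _)) 1f≈0))
  adjacent-oneVertex⇒unit≈1 _ (_ , inj₂ (1v≈1 , _)) = trans (sym (*-identityˡ _)) 1v≈1

module _ {c ℓ} (R : Ring c ℓ) (finite : IsFiniteRing R) where
  open Ring R
  private enumR = proj₂ finite

  infix 4 _≈?_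
  _≈?_ : Decidable _≈_
  _≈?_ = enumeration⇒≈-dec enumR

  IsUnit? : U.Decidable (IsUnit R)
  IsUnit? x = enumeration⇒∃? enumR (λ v → (x * v ≈? 1#) ×-dec (v * x ≈? 1#))
    λ v≈w (xv≈1 , vx≈1) → trans (*-cong refl (sym v≈w)) xv≈1 , trans (*-cong (sym v≈w) refl) vx≈1

  Id-enumeration : ∃ λ k → Enumeration k (IdSetoid R)
  Id-enumeration = subsetoid-enumeration enumR (λ x → x * x ≈? x) (IsIdempotent-resp R)

  NonzeroId-enumeration : ∃ λ k → Enumeration k (NonzeroIdSetoid R)
  NonzeroId-enumeration = subsetoid-enumeration enumR (λ x → (x * x ≈? x) ×-dec ¬? (x ≈? 0#))
    λ x≈y (x²≈x , x≉0) → IsIdempotent-resp R x≈y x²≈x , λ y≈0 → x≉0 (trans x≈y y≈0)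

  U-enumeration : ∃ λ k → Enumeration k (USetoid R)
  U-enumeration = subsetoid-enumeration enumR IsUnit? (IsUnit-resp R)

module _ {c₁ ℓ₁ c₂ ℓ₂} {R : Ring c₁ ℓ₁} {S : Ring c₂ ℓ₂} where

  Cl₂Iso-sym : Cl₂Iso R S → Cl₂Iso S R
  Cl₂Iso-sym (φ , adj) = Symmetry.inverse φ , λ x y →
      proj₂ (adj (from x) (from y)) ∘ into-image {x} {y}
    , out-of-image {x} {y} ∘ proj₁ (adj (from x) (from y))
    where
    open Inverse φ
    open Setoid (Cl₂Setoid S) using (sym)
    into-image : ∀ {x y} → Cl₂Adj S x y → Cl₂Adj S (to (from x)) (to (from y))
    into-image {x} {y} = Cl₂Adj-resp-≈ S {x} {to (from x)} {y} {to (from y)}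
      (sym {to (from x)} {x} (strictlyInverseˡ x)) (sym {to (from y)} {y} (strictlyInverseˡ y))
    out-of-image : ∀ {x y} → Cl₂Adj S (to (from x)) (to (from y)) → Cl₂Adj S x y
    out-of-image {x} {y} = Cl₂Adj-resp-≈ S {to (from x)} {x} {to (from y)} {y}
      (strictlyInverseˡ x) (strictlyInverseˡ y)

  Cl₂Iso-nontrivial : Cl₂Iso R S → ¬ IsTrivial R → ¬ IsTrivial S
  Cl₂Iso-nontrivial (φ , _) 1≉0 1≈0 = trivial⇒no-vertex S 1≈0 (Inverse.to φ (oneVertex R 1≉0))

Cl₂Iso-trivial : ∀ {c₁ ℓ₁ c₂ ℓ₂} {R : Ring c₁ ℓ₁} {S : Ring c₂ ℓ₂} →
  IsFiniteRing S → Cl₂Iso R S → IsTrivial R → IsTrivial S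
Cl₂Iso-trivial {S = S} finite iso 1≈0 = decidable-stable (_≈?_ S finite (Ring.1# S) (Ring.0# S)) λ 1≉0 →
  Cl₂Iso-nontrivial (Cl₂Iso-sym iso) 1≉0 1≈0

module _ {c₁ ℓ₁ c₂ ℓ₂} {R : Ring c₁ ℓ₁} {S : Ring c₂ ℓ₂} (finite : IsFiniteRing R)
         (iso : Cl₂Iso R S) (1≉0 : ¬ IsTrivial R) where
  private
    module R = Ring R
    module S = Ring S
    open Inverse (proj₁ iso)

    x₀ : Cl₂Vertex R
    x₀ = oneVertex R 1≉0

    partner : Setoid.Carrier (NonzeroIdSetoid S) → Cl₂Vertex S
    partner (f , f² , f≉0) =
      let (u⁻¹ , uu⁻¹≈1 , u⁻¹u≈1) = isUnit (to x₀) in vtx f f² f≉0 u⁻¹ (unit (to x₀) , u⁻¹u≈1 , uu⁻¹≈1)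

    pulled : Setoid.Carrier (NonzeroIdSetoid S) → Cl₂Vertex R
    pulled = from ∘ partner

    unit-pulled≈1 : ∀ f → unit (pulled f) R.≈ R.1#
    unit-pulled≈1 f = decidable-stable (_≈?_ R finite (unit (pulled f)) R.1#) λ u≉1 →
      u≉1 (adjacent-oneVertex⇒unit≈1 R 1≉0 {pulled f} (proj₂ (proj₂ iso x₀ (pulled f)) (adjacent u≉1)))
      where
      distinct : ¬ unit (pulled f) R.≈ R.1# → ¬ Setoid._≈_ (Cl₂Setoid S) (to x₀) (partner f)
      distinct u≉1 (e≈f , u≈u⁻¹) = u≉1 (proj₂ (inverseʳ {x₀} {partner f} (S.sym e≈f , S.sym u≈u⁻¹)))

      adjacent : ¬ unit (pulled f) R.≈ R.1# → Cl₂Adj S (to x₀) (to (pulled f))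
      adjacent u≉1 = Cl₂Adj-resp-≈ S {to x₀} {to x₀} {partner f} {to (pulled f)}
        (S.refl , S.refl)
        (Setoid.sym (Cl₂Setoid S) {to (pulled f)} {partner f} (strictlyInverseˡ (partner f)))
        (distinct u≉1 , inj₂ (proj₂ (isUnit (to x₀))))

  Cl₂Iso⇒NonzeroId-injection : Injection (NonzeroIdSetoid S) (NonzeroIdSetoid R)
  Cl₂Iso⇒NonzeroId-injection = record
    { to = λ f → idem (pulled f) , isIdem (pulled f) , nonzero (pulled f)
    ; cong = λ f≈g → proj₁ (from-cong (f≈g , S.refl))
    ; injective = λ {f} {g} e≈e′ →
        proj₁ (from-injective (e≈e′ , R.trans (unit-pulled≈1 f) (R.sym (unit-pulled≈1 g)))) }
    where
    from-injective : ∀ {x y} → Setoid._≈_ (Cl₂Setoid R) (from x) (from y) → Setoid._≈_ (Cl₂Setoid S) x y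
    from-injective = Injection.injective (Inverse⇒Injection (Symmetry.inverse (proj₁ iso)))

module _ {c₁ ℓ₁ c₂ ℓ₂} (R : Ring c₁ ℓ₁) (S : Ring c₂ ℓ₂) (_≈?_ : Decidable (Ring._≈_ R))
         (g : Injection (NonzeroIdSetoid R) (NonzeroIdSetoid S)) where
  private
    module R = Ring R
    module S = Ring S
    module g = Injection g

    extend : ∀ e → IsIdempotent R e → Dec (e R.≈ R.0#) → Σ S.Carrier (IsIdempotent S)
    extend _ _  (yes _)   = S.0# , S.zeroˡ S.0#
    extend e e² (no e≉0) = map₂ proj₁ (g.to (e , e² , e≉0))

    extend-cong : ∀ {e e′} e² e′² d d′ → e R.≈ e′ → proj₁ (extend e e² d) S.≈ proj₁ (extend e′ e′² d′)
    extend-cong _ _ (yes _)   (yes _)    _    = S.refl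
    extend-cong _ _ (yes e≈0) (no e′≉0)  e≈e′ = ⊥-elim (e′≉0 (R.trans (R.sym e≈e′) e≈0))
    extend-cong _ _ (no e≉0)  (yes e′≈0) e≈e′ = ⊥-elim (e≉0 (R.trans e≈e′ e′≈0))
    extend-cong _ _ (no _)    (no _)     e≈e′ = g.cong e≈e′

    extend-injective : ∀ {e e′} e² e′² d d′ → proj₁ (extend e e² d) S.≈ proj₁ (extend e′ e′² d′) → e R.≈ e′
    extend-injective _ _ (yes e≈0) (yes e′≈0) _ = R.trans e≈0 (R.sym e′≈0)
    extend-injective {_} {e′} _ e′² (yes _) (no e′≉0) 0≈f′ =
      ⊥-elim (proj₂ (proj₂ (g.to (e′ , e′² , e′≉0))) (S.sym 0≈f′))
    extend-injective {e} e² _ (no e≉0) (yes _) f≈0 = ⊥-elim (proj₂ (proj₂ (g.to (e , e² , e≉0))) f≈0)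
    extend-injective _ _ (no _) (no _) f≈f′ = g.injective f≈f′

  NonzeroId-injection⇒Id-injection : Injection (IdSetoid R) (IdSetoid S)
  NonzeroId-injection⇒Id-injection = record
    { to = λ (e , e²) → extend e e² (e ≈? R.0#)
    ; cong = λ {(e , e²)} {(e′ , e′²)} → extend-cong e² e′² (e ≈? R.0#) (e′ ≈? R.0#)
    ; injective = λ {(e , e²)} {(e′ , e′²)} → extend-injective e² e′² (e ≈? R.0#) (e′ ≈? R.0#) }

module _ {c₁ ℓ₁ c₂ ℓ₂} {R : Ring c₁ ℓ₁} {S : Ring c₂ ℓ₂}
         (finiteR : IsFiniteRing R) (finiteS : IsFiniteRing S)
         (iso : Cl₂Iso R S) (1≉0 : ¬ IsTrivial R) where
  private
    NonzeroIdS↣NonzeroIdR : Injection (NonzeroIdSetoid S) (NonzeroIdSetoid R)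
    NonzeroIdS↣NonzeroIdR = Cl₂Iso⇒NonzeroId-injection finiteR iso 1≉0

    NonzeroIdR↣NonzeroIdS : Injection (NonzeroIdSetoid R) (NonzeroIdSetoid S)
    NonzeroIdR↣NonzeroIdS = Cl₂Iso⇒NonzeroId-injection finiteS (Cl₂Iso-sym iso) (Cl₂Iso-nontrivial iso 1≉0)

  nontrivial-Cl₂Iso⇒Id≅ : IdSetoid R ≅ˢ IdSetoid S
  nontrivial-Cl₂Iso⇒Id≅ with Id-enumeration R finiteR | Id-enumeration S finiteS
  ... | _ , enumR | _ , enumS = ≡⇒Inverse (injections⇒≡ enumR enumS IdR↣IdS IdS↣IdR) enumR enumS
    where
    IdR↣IdS : Injection (IdSetoid R) (IdSetoid S)
    IdR↣IdS = NonzeroId-injection⇒Id-injection R S (_≈?_ R finiteR) NonzeroIdR↣NonzeroIdS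
    IdS↣IdR : Injection (IdSetoid S) (IdSetoid R)
    IdS↣IdR = NonzeroId-injection⇒Id-injection S R (_≈?_ S finiteS) NonzeroIdS↣NonzeroIdR

  nontrivial-Cl₂Iso⇒U≅ : USetoid R ≅ˢ USetoid S
  nontrivial-Cl₂Iso⇒U≅
    with NonzeroId-enumeration R finiteR | NonzeroId-enumeration S finiteS
       | U-enumeration R finiteR | U-enumeration S finiteS
  ... | aR , enumIdR* | aS , enumIdS* | bR , enumUR | bS , enumUS = ≡⇒Inverse |UR|≡|US| enumUR enumUS
    where
    open ≡.≡-Reasoning

    |IdR*|≡|IdS*| : aR ≡ aS
    |IdR*|≡|IdS*| = injections⇒≡ enumIdR* enumIdS* NonzeroIdR↣NonzeroIdS NonzeroIdS↣NonzeroIdR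

    |Cl₂R|≡|Cl₂S| : aR ℕ.* bR ≡ aS ℕ.* bS
    |Cl₂R|≡|Cl₂S| =
      Inverse⇒≡ (Cl₂-enumeration R enumIdR* enumUR) (Cl₂-enumeration S enumIdS* enumUS) (proj₁ iso)

    instance
      aR-nonZero : ℕ.NonZero aR
      aR-nonZero = nonZeroIndex (Inverse.from enumIdR* (Ring.1# R , Ring.*-identityˡ R (Ring.1# R) , 1≉0))

    |UR|≡|US| : bR ≡ bS
    |UR|≡|US| = *-cancelˡ-≡ bR bS aR (begin
      aR ℕ.* bR  ≡⟨ |Cl₂R|≡|Cl₂S| ⟩
      aS ℕ.* bS  ≡⟨ ≡.cong (ℕ._* bS) |IdR*|≡|IdS*| ⟨
      aR ℕ.* bS  ∎)

mainTheorem3 : ∀ {c₁ ℓ₁ c₂ ℓ₂ : Level} (R : Ring c₁ ℓ₁) (S : Ring c₂ ℓ₂) →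
    IsFiniteRing R → IsFiniteRing S → Cl₂Iso R S →
    (IdSetoid R ≅ˢ IdSetoid S) × (USetoid R ≅ˢ USetoid S)
mainTheorem3 R S finiteR finiteS iso with _≈?_ R finiteR (Ring.1# R) (Ring.0# R)
... | no 1≉0 = nontrivial-Cl₂Iso⇒Id≅ finiteR finiteS iso 1≉0 , nontrivial-Cl₂Iso⇒U≅ finiteR finiteS iso 1≉0
... | yes 1≈0 =
  let 1≈0ˢ = Cl₂Iso-trivial finiteS iso 1≈0 in
    singletons⇒Inverse (trivial⇒Id-singleton R 1≈0) (trivial⇒Id-singleton S 1≈0ˢ)
  , singletons⇒Inverse (trivial⇒U-singleton R 1≈0) (trivial⇒U-singleton S 1≈0ˢ)
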